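{- Let $s<t$ be relatively prime positive integers. Let $\beta,\gamma$ be beta-sets with $\beta\subsetneq\gamma$ and $\beta\prec\gamma$, and let $k=\min(\gamma\setminus\beta)$. If $\beta$ and $\gamma$ are both $(s,t)$-closed, then $\beta\cup\{k\}$ is $(s,t)$-closed; if $\beta$ and $\gamma$ are both $(s,t)$-core, then $\beta\cup\{k\}$ is $(s,t)$-core.
   Context: A beta-set is a finite set of positive integers written decreasingly $\{\beta_1>\dots>\beta_n\}$, with associated partition $P(\beta)=(\beta_1-(n-1),\dots,\beta_n)$. For partitions $P=(P_1,\dots,P_n)$, $Q=(Q_1,\dots,Q_m)$ write $P<Q$ if $n\le m$ and $P_i\le Q_i$ for $i\le n$; $\beta\prec\gamma$ means $P(\beta)<P(\gamma)$. $\beta$ is $(s,t)$-closed if for every $x\in\beta$: $x>s\Rightarrow x-s\in\beta$, $x>t\Rightarrow x-t\in\beta$. The hook number of box $(i,j)$ ($j\le P_i$) of a partition $P$ is $(P_i-j)+\#\{k>i:P_k\ge j\}+1$; a partition is $t$-core if no hook number is divisible by $t$; a beta-set is $(s,t)$-core if $P(\beta)$ is both $s$-core and $t$-core. -}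

module Defs where

open import Data.Nat using (ℕ; zero; suc; _+_; _∸_; _≤_; _<_; _≤?_; _<ᵇ_)
open import Data.Nat.Divisibility using (_∣_)
open import Data.Bool using (if_then_else_)
open import Data.List using (List; []; _∷_; length; filter; drop; lookup)
open import Data.List.Relation.Unary.All using (All)
open import Data.List.Relation.Unary.Linked using (Linked)
open import Data.List.Membership.Propositional using (_∈_; _∉_)
open import Data.Fin using (Fin; toℕ)
open import Data.Product using (_×_; ∃-syntax)
open import Relation.Nullary using (¬_)

-- A beta-set is represented by the list of its elements written
-- decreasingly: strictly decreasing list of positive integers.
IsBetaSet : List ℕ → Set
IsBetaSet β = Linked (λ x y → y < x) β × All (λ x → 0 < x) β

partition : List ℕ → List ℕ
partition []       = []
partition (x ∷ xs) = (x ∸ length xs) ∷ partition xs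

data _<P_ : List ℕ → List ℕ → Set where
  []<P  : ∀ {Q} → [] <P Q
  ∷<P   : ∀ {p q P Q} → p ≤ q → P <P Q → (p ∷ P) <P (q ∷ Q)

_≺_ : List ℕ → List ℕ → Set
β ≺ γ = partition β <P partition γ

Closed : ℕ → ℕ → List ℕ → Set
Closed s t β = ∀ x → x ∈ β → (s < x → (x ∸ s) ∈ β) × (t < x → (x ∸ t) ∈ β)

-- Hook number of box (i , j) (i 0-indexed row via Fin, j ≥ 1 column):
-- (P_i - j) + #{k > i : P_k ≥ j} + 1
hook : (P : List ℕ) → Fin (length P) → ℕ → ℕ
hook P i j = (lookup P i ∸ j) + length (filter (j ≤?_) (drop (suc (toℕ i)) P)) + 1

IsCore : ℕ → List ℕ → Set
IsCore t P = ∀ (i : Fin (length P)) (j : ℕ) → 1 ≤ j → j ≤ lookup P i → ¬ (t ∣ hook P i j)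

STCore : ℕ → ℕ → List ℕ → Set
STCore s t β = IsCore s (partition β) × IsCore t (partition β)

_⊆_ : List ℕ → List ℕ → Set
β ⊆ γ = ∀ x → x ∈ β → x ∈ γ

_⊊_ : List ℕ → List ℕ → Set
β ⊊ γ = β ⊆ γ × ∃[ x ] (x ∈ γ × x ∉ β)

IsMinDiff : ℕ → List ℕ → List ℕ → Set
IsMinDiff k γ β = (k ∈ γ × k ∉ β) × (∀ y → y ∈ γ → y ∉ β → k ≤ y)

-- insert k into a decreasing list (gives the decreasing list of β ∪ {k}
-- when k ∉ β)
insertDesc : ℕ → List ℕ → List ℕ
insertDesc k []       = k ∷ []
insertDesc k (x ∷ xs) = if x <ᵇ k then k ∷ x ∷ xs else x ∷ insertDesc k xs

-- The row of P(β) belonging to x ∈ β has one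
-- box for each gap y < x of β (y ∉ β, y ≥ 0), and that box has hook length
-- x − y.  Hence P(β) is a u-core iff β is closed under x ↦ y for y < x with
-- u ∣ x − y.  Being (s,t)-closed is a closure property of the same shape
-- (x ↦ x − s, x ↦ x − t).  Any such property passes from β and γ to
-- β ∪ {k} when k = min (γ ∖ β): whatever is reached from k lies in γ below
-- k, hence in β.
module Submission where

open import Defs
open import Data.Nat using (ℕ; _<_)
open import Data.Nat.Coprimality using (Coprime)
open import Data.List using (List)
open import Data.Product using (_×_)

open import Data.Nat using (zero; suc; _+_; _∸_; _≤_; _≤?_; _<ᵇ_; z≤n; s≤s; pred; _≟_)
open import Data.Nat.Properties
open import Data.Nat.Divisibility using (_∣_)
open import Data.Nat.Solver using (module +-*-Solver)
open import Data.Bool using (true; false; T)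
open import Data.List using ([]; _∷_; length; filter)
open import Data.List.Properties using (filter-accept; filter-reject)
open import Data.List.Relation.Unary.All as All using (All; []; _∷_)
open import Data.List.Relation.Unary.AllPairs using (AllPairs; []; _∷_)
open import Data.List.Relation.Unary.Linked using (Linked)
open import Data.List.Relation.Unary.Linked.Properties using (Linked⇒AllPairs)
open import Data.List.Relation.Unary.Any using (here; there)
open import Data.List.Membership.Propositional using (_∈_; _∉_)
open import Data.List.Membership.DecPropositional _≟_ using (_∈?_)
open import Data.Product using (_,_; ∃-syntax; proj₁; proj₂)
open import Data.Sum using (_⊎_; inj₁; inj₂)
open import Data.Empty using (⊥-elim)
open import Data.Unit using (tt)
open import Data.Fin using () renaming (zero to fzero; suc to fsuc)
open import Relation.Nullary using (¬_; yes; no)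
open import Relation.Binary.PropositionalEquality
open import Relation.Binary.Definitions using (tri<; tri≈; tri>)
open import Function using (_∘_)

Descending : List ℕ → Set
Descending = AllPairs (λ x y → y < x)

linked⇒descending : ∀ {xs} → Linked (λ x y → y < x) xs → Descending xs
linked⇒descending = Linked⇒AllPairs (λ y<x z<y → <-trans z<y y<x)

DownClosed : (ℕ → ℕ → Set) → List ℕ → Set
DownClosed R β = ∀ {x y} → x ∈ β → y < x → R x y → y ∈ β

downClosed-∷⁻ : ∀ {R x xs} → All (_< x) xs → DownClosed R (x ∷ xs) → DownClosed R xs
downClosed-∷⁻ below closed x∈ y<x Rxy with closed (there x∈) y<x Rxy
... | here refl = ⊥-elim (<-asym y<x (All.lookup below x∈))
... | there y∈  = y∈

countAtLeast : ℕ → List ℕ → ℕ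
countAtLeast j P = length (filter (j ≤?_) P)

countAtLeast-accept : ∀ {j p} P → j ≤ p → countAtLeast j (p ∷ P) ≡ suc (countAtLeast j P)
countAtLeast-accept _ j≤p = cong length (filter-accept (_ ≤?_) j≤p)

countAtLeast-reject : ∀ {j p} P → ¬ j ≤ p → countAtLeast j (p ∷ P) ≡ countAtLeast j P
countAtLeast-reject _ j≰p = cong length (filter-reject (_ ≤?_) j≰p)

countAtLeast-below : ∀ {j} P → All (_< j) P → countAtLeast j P ≡ 0
countAtLeast-below []      []            = refl
countAtLeast-below (p ∷ P) (p<j ∷ P<j) =
  trans (countAtLeast-reject P (<⇒≱ p<j)) (countAtLeast-below P P<j)

length≤head : ∀ {z zs} → All (_< z) zs → Descending zs → length zs ≤ z
length≤head []           []           = z≤n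
length≤head (w<z ∷ _) (w>ws ∷ desc) = ≤-trans (s≤s (length≤head w>ws desc)) w<z

partition-belowHead : ∀ {z zs} → All (_< z) zs → Descending zs →
                      All (_≤ z ∸ length zs) (partition zs)
partition-belowHead []                      []           = []
partition-belowHead {z} {w ∷ ws} (w<z ∷ _) (w>ws ∷ desc) =
  first ∷ All.map (λ p≤ → ≤-trans p≤ first) (partition-belowHead w>ws desc)
  where
  first : w ∸ length ws ≤ z ∸ length (w ∷ ws)
  first = ∸-monoˡ-≤ (suc (length ws)) w<z

-- nthGap xs j is the j-th smallest natural number outside xs (j counted from 1)
-- when xs is descending.
nthGap : List ℕ → ℕ → ℕ
nthGap []       j = pred j
nthGap (z ∷ zs) j with j ≤? z ∸ length zs
... | yes _ = nthGap zs j
... | no  _ = suc (nthGap zs j)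

nthGap-∷-≤ : ∀ {z zs j} → j ≤ z ∸ length zs → nthGap (z ∷ zs) j ≡ nthGap zs j
nthGap-∷-≤ {z} {zs} {j} j≤ with j ≤? z ∸ length zs
... | yes _  = refl
... | no j≰ = ⊥-elim (j≰ j≤)

nthGap-∷-≰ : ∀ {z zs j} → ¬ j ≤ z ∸ length zs → nthGap (z ∷ zs) j ≡ suc (nthGap zs j)
nthGap-∷-≰ {z} {zs} {j} j≰ with j ≤? z ∸ length zs
... | yes j≤ = ⊥-elim (j≰ j≤)
... | no _   = refl

-- The positions 0, …, nthGap xs j hold exactly j gaps, and the elements of xs
-- above them are those whose part is at least j.
nthGap-countAtLeast : ∀ xs {j} → 1 ≤ j →
  suc (nthGap xs j + countAtLeast j (partition xs)) ≡ length xs + j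
nthGap-countAtLeast []       {suc j} _ = cong suc (+-identityʳ j)
nthGap-countAtLeast (z ∷ zs) {j} 1≤j with j ≤? z ∸ length zs
... | yes j≤ = begin
  suc (nthGap zs j + countAtLeast j ((z ∸ length zs) ∷ partition zs))
    ≡⟨ cong (λ c → suc (nthGap zs j + c)) (countAtLeast-accept (partition zs) j≤) ⟩
  suc (nthGap zs j + suc (countAtLeast j (partition zs)))
    ≡⟨ cong suc (+-suc (nthGap zs j) _) ⟩
  suc (suc (nthGap zs j + countAtLeast j (partition zs)))
    ≡⟨ cong suc (nthGap-countAtLeast zs 1≤j) ⟩
  suc (length zs + j) ∎
  where open ≡-Reasoning
... | no j≰ = begin
  suc (suc (nthGap zs j) + countAtLeast j ((z ∸ length zs) ∷ partition zs))
    ≡⟨ cong (λ c → suc (suc (nthGap zs j) + c)) (countAtLeast-reject (partition zs) j≰) ⟩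
  suc (suc (nthGap zs j + countAtLeast j (partition zs)))
    ≡⟨ cong suc (nthGap-countAtLeast zs 1≤j) ⟩
  suc (length zs + j) ∎
  where open ≡-Reasoning

nthGap<head : ∀ {z zs j} → All (_< z) zs → Descending zs → 1 ≤ j →
              j ≤ z ∸ length zs → nthGap zs j < z
nthGap<head {z} {zs} {j} below desc 1≤j j≤ = begin
  suc (nthGap zs j)                                   ≤⟨ s≤s (m≤m+n _ _) ⟩
  suc (nthGap zs j + countAtLeast j (partition zs))   ≡⟨ nthGap-countAtLeast zs 1≤j ⟩
  length zs + j                                       ≤⟨ +-monoʳ-≤ (length zs) j≤ ⟩
  length zs + (z ∸ length zs)                         ≡⟨ m+[n∸m]≡n (length≤head below desc) ⟩
  z                                                   ∎
  where open ≤-Reasoning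

-- For j beyond the row length of z no part of zs reaches column j.
head≤nthGap : ∀ {z zs j} → All (_< z) zs → Descending zs → 1 ≤ j →
              ¬ j ≤ z ∸ length zs → z ≤ nthGap zs j
head≤nthGap {z} {zs} {j} below desc 1≤j j≰ = ≤-pred (begin
  suc z                                               ≡⟨ cong suc (m+[n∸m]≡n (length≤head below desc)) ⟨
  suc (length zs + (z ∸ length zs))                   ≡⟨ +-suc (length zs) _ ⟨
  length zs + suc (z ∸ length zs)                     ≤⟨ +-monoʳ-≤ (length zs) (≰⇒> j≰) ⟩
  length zs + j                                       ≡⟨ nthGap-countAtLeast zs 1≤j ⟨
  suc (nthGap zs j + countAtLeast j (partition zs))   ≡⟨ cong (λ c → suc (nthGap zs j + c)) noneReach ⟩
  suc (nthGap zs j + 0)                               ≡⟨ cong suc (+-identityʳ _) ⟩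
  suc (nthGap zs j)                                   ∎)
  where
  open ≤-Reasoning
  noneReach : countAtLeast j (partition zs) ≡ 0
  noneReach = countAtLeast-below (partition zs)
    (All.map (λ p≤ → <-≤-trans (s≤s p≤) (≰⇒> j≰)) (partition-belowHead below desc))

nthGap∉ : ∀ {xs j} → Descending xs → 1 ≤ j → nthGap xs j ∉ xs
nthGap∉ {z ∷ zs} {j} (below ∷ desc) 1≤j z∈ with j ≤? z ∸ length zs | z∈
... | yes j≤ | here eq   = <⇒≢ (nthGap<head below desc 1≤j j≤) eq
... | yes _  | there y∈  = nthGap∉ desc 1≤j y∈
... | no j≰  | here eq   = <⇒≢ (s≤s (head≤nthGap below desc 1≤j j≰)) (sym eq)
... | no j≰  | there y∈  =
  <⇒≱ (All.lookup below y∈) (m≤n⇒m≤1+n (head≤nthGap below desc 1≤j j≰))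

gap⇒nthGap : ∀ {xs x y} → Descending xs → All (_< x) xs → y < x → y ∉ xs →
             ∃[ j ] (1 ≤ j × j ≤ x ∸ length xs × nthGap xs j ≡ y)
gap⇒nthGap {[]} {y = y} [] [] y<x _ = suc y , s≤s z≤n , y<x , refl
gap⇒nthGap {z ∷ zs} {x} {y} (below ∷ desc) (z<x ∷ _) y<x y∉ with <-cmp y z
... | tri≈ _ y≡z _ = ⊥-elim (y∉ (here y≡z))
... | tri< y<z _ _ with gap⇒nthGap desc below y<z (y∉ ∘ there)
...   | j , 1≤j , j≤ , eq =
  j , 1≤j , ≤-trans j≤ (∸-monoˡ-≤ (suc (length zs)) z<x) , trans (nthGap-∷-≤ j≤) eq
gap⇒nthGap {z ∷ zs} {suc x} {suc y} (below ∷ desc) _ (s≤s y<x) y∉ | tri> _ _ (s≤s z≤y)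
  with gap⇒nthGap desc (All.map (λ w<z → <-≤-trans w<z (≤-trans z≤y (<⇒≤ y<x))) below) y<x
                  (λ y∈ → <⇒≱ (All.lookup below y∈) z≤y)
... | j , 1≤j , j≤ , eq = j , 1≤j , j≤ , trans (nthGap-∷-≰ j≰) (cong suc eq)
  where
  j≰ : ¬ j ≤ z ∸ length zs
  j≰ j≤′ = <⇒≱ (nthGap<head below desc 1≤j j≤′) (subst (z ≤_) (sym eq) z≤y)

hook-firstRow : ∀ {x xs j} → All (_< x) xs → Descending xs → 1 ≤ j → j ≤ x ∸ length xs →
                hook (partition (x ∷ xs)) fzero j + nthGap xs j ≡ x
hook-firstRow {x} {xs} {j} below desc 1≤j j≤ = begin
  (((x ∸ n) ∸ j) + c + 1) + nthGap xs j   ≡⟨ shuffle ((x ∸ n) ∸ j) c (nthGap xs j) ⟩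
  ((x ∸ n) ∸ j) + suc (nthGap xs j + c)   ≡⟨ cong (((x ∸ n) ∸ j) +_) (nthGap-countAtLeast xs 1≤j) ⟩
  ((x ∸ n) ∸ j) + (n + j)                 ≡⟨ cong (((x ∸ n) ∸ j) +_) (+-comm n j) ⟩
  ((x ∸ n) ∸ j) + (j + n)                 ≡⟨ +-assoc ((x ∸ n) ∸ j) j n ⟨
  (((x ∸ n) ∸ j) + j) + n                 ≡⟨ cong (_+ n) (m∸n+n≡m j≤) ⟩
  (x ∸ n) + n                             ≡⟨ m∸n+n≡m (length≤head below desc) ⟩
  x                                       ∎
  where
  open ≡-Reasoning
  n = length xs
  c = countAtLeast j (partition xs)
  shuffle : ∀ a c g → ((a + c) + 1) + g ≡ a + suc (g + c)
  shuffle = solve 3 (λ a c g → ((a :+ c) :+ con 1) :+ g := a :+ (con 1 :+ (g :+ c))) refl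
    where open +-*-Solver

hook-firstRow-∸ : ∀ {x xs j} → All (_< x) xs → Descending xs → 1 ≤ j → j ≤ x ∸ length xs →
                  x ∸ nthGap xs j ≡ hook (partition (x ∷ xs)) fzero j
hook-firstRow-∸ {xs = xs} {j} below desc 1≤j j≤ =
  trans (cong (_∸ nthGap xs j) (sym (hook-firstRow below desc 1≤j j≤))) (m+n∸n≡m (hook (partition (_ ∷ xs)) fzero j) (nthGap xs j))

nthGap<first : ∀ {x xs j} → All (_< x) xs → Descending xs → 1 ≤ j → j ≤ x ∸ length xs →
               nthGap xs j < x
nthGap<first {xs = xs} {j} below desc 1≤j j≤ =
  subst (suc (nthGap xs j) ≤_) (hook-firstRow below desc 1≤j j≤)
        (+-monoˡ-≤ (nthGap xs j) (m≤n+m 1 _))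

DivDown : ℕ → ℕ → ℕ → Set
DivDown u x y = u ∣ x ∸ y

isCore⇒downClosed : ∀ {u xs} → Descending xs → IsCore u (partition xs) → DownClosed (DivDown u) xs
isCore⇒downClosed {u} {x ∷ xs} (below ∷ desc) core {y = y} (here refl) y<x u∣ with y ∈? xs
... | yes y∈ = there y∈
... | no y∉ with gap⇒nthGap desc below y<x y∉
...   | j , 1≤j , j≤ , refl = ⊥-elim (core fzero j 1≤j j≤ (subst (u ∣_) (hook-firstRow-∸ below desc 1≤j j≤) u∣))
isCore⇒downClosed (_ ∷ desc) core (there x∈) y<x u∣ =
  there (isCore⇒downClosed desc (λ i → core (fsuc i)) x∈ y<x u∣)

downClosed⇒isCore : ∀ {u xs} → Descending xs → DownClosed (DivDown u) xs → IsCore u (partition xs)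
downClosed⇒isCore {u} {x ∷ xs} (below ∷ desc) closed fzero j 1≤j j≤ u∣hook
  with closed (here refl) gap<x (subst (u ∣_) (sym (hook-firstRow-∸ below desc 1≤j j≤)) u∣hook)
  where
  gap<x = nthGap<first below desc 1≤j j≤
... | here eq   = <⇒≢ (nthGap<first below desc 1≤j j≤) eq
... | there gap∈ = nthGap∉ desc 1≤j gap∈
downClosed⇒isCore (below ∷ desc) closed (fsuc i) =
  downClosed⇒isCore desc (downClosed-∷⁻ below closed) i

StepDown : ℕ → ℕ → ℕ → ℕ → Set
StepDown s t x y = (s < x × y ≡ x ∸ s) ⊎ (t < x × y ≡ x ∸ t)

closed⇒downClosed : ∀ {s t β} → Closed s t β → DownClosed (StepDown s t) β
closed⇒downClosed closed x∈ _ (inj₁ (s<x , refl)) = proj₁ (closed _ x∈) s<x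
closed⇒downClosed closed x∈ _ (inj₂ (t<x , refl)) = proj₂ (closed _ x∈) t<x

downClosed⇒closed : ∀ {s t β} → 0 < s → 0 < t → DownClosed (StepDown s t) β → Closed s t β
downClosed⇒closed 0<s 0<t closed x x∈ =
  (λ s<x → closed x∈ (∸-monoʳ-< 0<s (<⇒≤ s<x)) (inj₁ (s<x , refl))) ,
  (λ t<x → closed x∈ (∸-monoʳ-< 0<t (<⇒≤ t<x)) (inj₂ (t<x , refl)))

∈-insertDesc⁻ : ∀ {k β z} → z ∈ insertDesc k β → z ≡ k ⊎ z ∈ β
∈-insertDesc⁻ {β = []} (here eq) = inj₁ eq
∈-insertDesc⁻ {k} {x ∷ xs} z∈ with x <ᵇ k | z∈
... | true  | here eq  = inj₁ eq
... | true  | there z∈β = inj₂ z∈β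
... | false | here eq  = inj₂ (here eq)
... | false | there z∈′ with ∈-insertDesc⁻ z∈′
...   | inj₁ eq  = inj₁ eq
...   | inj₂ z∈xs = inj₂ (there z∈xs)

∈-insertDesc⁺ : ∀ {k β z} → z ∈ β → z ∈ insertDesc k β
∈-insertDesc⁺ {k} {x ∷ xs} z∈ with x <ᵇ k | z∈
... | true  | _         = there z∈
... | false | here eq   = here eq
... | false | there z∈xs = there (∈-insertDesc⁺ z∈xs)

insertDesc-descending : ∀ {k β} → k ∉ β → Descending β → Descending (insertDesc k β)
insertDesc-descending {β = []} _ [] = [] ∷ []
insertDesc-descending {k} {x ∷ xs} k∉ (below ∷ desc) with x <ᵇ k in eq
... | true  = (x<k ∷ All.map (λ y<x → <-trans y<x x<k) below) ∷ below ∷ desc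
  where
  x<k : x < k
  x<k = <ᵇ⇒< x k (subst T (sym eq) tt)
... | false = All.tabulate belowX ∷ insertDesc-descending (k∉ ∘ there) desc
  where
  belowX : ∀ {z} → z ∈ insertDesc k xs → z < x
  belowX z∈ with ∈-insertDesc⁻ z∈
  ... | inj₂ z∈xs = All.lookup below z∈xs
  ... | inj₁ refl = ≤∧≢⇒< (≮⇒≥ (λ x<k → subst T eq (<⇒<ᵇ x<k))) (k∉ ∘ here)

insertDesc-downClosed : ∀ {R β γ k} → DownClosed R β → DownClosed R γ → k ∈ γ →
                        (∀ y → y ∈ γ → y ∉ β → k ≤ y) → DownClosed R (insertDesc k β)
insertDesc-downClosed {β = β} closedβ closedγ k∈γ minimal {y = y} z∈ y<z Rzy
  with ∈-insertDesc⁻ z∈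
... | inj₂ z∈β = ∈-insertDesc⁺ (closedβ z∈β y<z Rzy)
... | inj₁ refl with y ∈? β
...   | yes y∈β = ∈-insertDesc⁺ y∈β
...   | no y∉β  = ⊥-elim (<⇒≱ y<z (minimal y (closedγ k∈γ y<z Rzy) y∉β))

mainTheorem13 : ∀ (s t : ℕ) → 0 < s → s < t → Coprime s t →
    ∀ (β γ : List ℕ) → IsBetaSet β → IsBetaSet γ → β ⊊ γ → β ≺ γ →
    ∀ (k : ℕ) → IsMinDiff k γ β →
    (Closed s t β → Closed s t γ → Closed s t (insertDesc k β))
    × (STCore s t β → STCore s t γ → STCore s t (insertDesc k β))
mainTheorem13 s t 0<s s<t _ β γ (linkedβ , _) (linkedγ , _) _ _ k ((k∈γ , k∉β) , minimal) =
  closedPart , corePart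
  where
  descβ = linked⇒descending linkedβ
  descγ = linked⇒descending linkedγ

  insert : ∀ {R} → DownClosed R β → DownClosed R γ → DownClosed R (insertDesc k β)
  insert closedβ closedγ = insertDesc-downClosed closedβ closedγ k∈γ minimal

  closedPart : Closed s t β → Closed s t γ → Closed s t (insertDesc k β)
  closedPart cβ cγ = downClosed⇒closed 0<s (<-trans 0<s s<t)
    (insert (closed⇒downClosed cβ) (closed⇒downClosed cγ))

  coreFor : ∀ u → IsCore u (partition β) → IsCore u (partition γ) →
            IsCore u (partition (insertDesc k β))
  coreFor u coreβ coreγ = downClosed⇒isCore (insertDesc-descending k∉β descβ)
    (insert (isCore⇒downClosed descβ coreβ) (isCore⇒downClosed descγ coreγ))

  corePart : STCore s t β → STCore s t γ → STCore s t (insertDesc k β)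
  corePart (βs , βt) (γs , γt) = coreFor s βs γs , coreFor t βt γt
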